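{- Let $n\ge 1$, let $a_0,\dots,a_n,x_1,x_2,\dots$ be indeterminates, let $p=p_n$, $q=q_n$ be the $n$-th convergent numerator and denominator of $[a_0,\dots,a_n]$, let $W=a_1,\dots,a_n$ and $\overline{W}=-a_n,\dots,-a_1$, and for $k\ge2$ let $S_k=[a_0,W_1,x_1,W_2,x_2,\dots,x_{k-1},W_k]$ with $W_i=W$ for $i$ odd and $W_i=\overline W$ for $i$ even. Then for all $k\ge2$, $$S_k=\frac{p}{q}+\frac1q\cdot\cfrac{(-1)^n}{x_1q+\cfrac{(-1)^n}{x_2q+\cfrac{(-1)^n}{\ddots+\cfrac{(-1)^n}{x_{k-2}q+\cfrac{(-1)^n}{x_{k-1}q}}}}}.$$
   Context: $[b_0,\dots,b_m]=b_0+\cfrac{1}{b_1+\cfrac{1}{\ddots+\cfrac1{b_m}}}$. Convergents: $p_0=a_0$, $q_0=1$, $p_1=a_0a_1+1$, $q_1=a_1$, $p_j=a_jp_{j-1}+p_{j-2}$, $q_j=a_jq_{j-1}+q_{j-2}$ for $j\ge2$. -}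

module Defs where

open import Level using (Level)
open import Data.Nat using (ℕ; zero; suc)
open import Data.Bool using (Bool; true; false; not)
open import Data.List using (List; []; _∷_; _++_; reverse; map)
open import Data.Product using (_×_; _,_)
open import Algebra.Bundles using (CommutativeRing)

-- Elements of
-- the field of fractions are represented by formal fractions (num , den),
-- with the usual operations; equality of formal fractions is
-- cross-multiplication.  Quantifying over all commutative rings and all
-- values of a_i, x_i is equivalent to the identity holding for the
-- indeterminates (take R = ℤ[a_0,…,a_n,x_1,x_2,…]).
module CF {c ℓ : Level} (R : CommutativeRing c ℓ) where
  open CommutativeRing R hiding (zero)

  Frac : Set c
  Frac = Carrier × Carrier

  infixl 6 _+F_
  infixl 7 _*F_ _/F_
  infix 4 _≈F_

  _+F_ : Frac → Frac → Frac
  (a , b) +F (c' , d) = (a * d + b * c' , b * d)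

  _*F_ : Frac → Frac → Frac
  (a , b) *F (c' , d) = (a * c' , b * d)

  _/F_ : Frac → Frac → Frac
  (a , b) /F (c' , d) = (a * d , b * c')

  _≈F_ : Frac → Frac → Set ℓ
  (a , b) ≈F (c' , d) = a * d ≈ c' * b

  emb : Carrier → Frac
  emb r = (r , 1#)

  cf : Carrier → List Carrier → Frac
  cf b []       = emb b
  cf b (c' ∷ cs) = emb b +F (emb 1# /F cf c' cs)

  conv : (ℕ → Carrier) → ℕ → Carrier × Carrier
  conv a zero = (a 0 , 1#)
  conv a (suc zero) = (a 0 * a 1 + 1# , a 1)
  conv a (suc (suc j)) with conv a (suc j) | conv a j
  ... | (p₁ , q₁) | (p₀ , q₀) = (a (suc (suc j)) * p₁ + p₀ , a (suc (suc j)) * q₁ + q₀)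

  pconv : (ℕ → Carrier) → ℕ → Carrier
  pconv a j with conv a j
  ... | (p , _) = p

  qconv : (ℕ → Carrier) → ℕ → Carrier
  qconv a j with conv a j
  ... | (_ , q) = q

  sgn : ℕ → Carrier
  sgn zero    = 1#
  sgn (suc n) = - sgn n

  range1 : ℕ → (ℕ → Carrier) → List Carrier
  range1 zero    f = []
  range1 (suc n) f = range1 n f ++ (f (suc n) ∷ [])

  W : ℕ → (ℕ → Carrier) → List Carrier
  W n a = range1 n a

  Wbar : ℕ → (ℕ → Carrier) → List Carrier
  Wbar n a = map -_ (reverse (range1 n a))

  odd : ℕ → Bool
  odd zero    = false
  odd (suc i) = not (odd i)

  block : ℕ → (ℕ → Carrier) → ℕ → List Carrier
  block n a i with odd i
  ... | true  = W n a
  ... | false = Wbar n a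

  -- words n a x i m = W_i, x_i, W_{i+1}, x_{i+1}, …, x_{i+m-1}, W_{i+m}
  words : ℕ → (ℕ → Carrier) → (ℕ → Carrier) → ℕ → ℕ → List Carrier
  words n a x i zero    = block n a i
  words n a x i (suc m) = block n a i ++ (x i ∷ words n a x (suc i) m)

  -- S_{m+1} = [a_0, W_1, x_1, W_2, …, x_m, W_{m+1}]
  S : ℕ → (ℕ → Carrier) → (ℕ → Carrier) → ℕ → Frac
  S n a x (suc m) = cf (a 0) (words n a x 1 m)
  S n a x zero    = cf (a 0) (words n a x 1 zero)   -- unused (k ≥ 2)

  T : ℕ → (ℕ → Carrier) → (ℕ → Carrier) → ℕ → ℕ → Frac
  T n a x j zero    = emb (sgn n) /F emb (x j * qconv a n)
  T n a x j (suc m) = emb (sgn n) /F (emb (x j * qconv a n) +F T n a x (suc j) m)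

  -- right-hand side for k = m + 2:  p/q + (1/q) · T(1, m)
  RHS : ℕ → (ℕ → Carrier) → (ℕ → Carrier) → ℕ → Frac
  RHS n a x m = (pconv a n , qconv a n) +F ((1# , qconv a n) *F T n a x 1 m)

-- In homogeneous coordinates (u , v) ↦ u / v, prefixing y to a continued
-- fraction is the linear map (u , v) ↦ (y u + v , u).  The word W acts by the
-- matrix M = [[α , β] , [γ , δ]] of a₁ … aₙ, with det M = (-1)ⁿ, q = α and
-- p = a₀α + γ, and W̄ acts by (-1)ⁿ times its mirror image [[α , -γ] , [-β , δ]].
-- For the tail R = [W_i , x_i , R′] of S_k put E = q/R - γ if W_i = W and
-- E = q/R + β if W_i = W̄.  Expanding the block, the terms in 1/R′ cancel
-- because of the determinant, leaving E = (-1)ⁿ / (x_i q + E′), where E′ is the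
-- quantity of the other kind for R′; for the last block E = 0.  So E for R_1 is
-- the continued fraction on the right, and S_k = a₀ + 1/R_1 = p/q + E/q.
module Submission where

open import Defs
open import Level using (Level)
open import Data.Nat using (ℕ; _≤_; _∸_; zero; suc; s≤s)
open import Data.Bool using (Bool; true; false; not)
open import Data.List using (List; []; _∷_; _++_; foldr; map)
open import Data.List.Properties using (foldr-++; reverse-++)
open import Data.Product using (_×_; _,_; Σ; proj₁; proj₂)
open import Algebra.Bundles using (CommutativeRing)
open import Relation.Binary.PropositionalEquality as ≡ using (_≡_)

-- The ring solver of the standard library needs a coefficient ring mapped
-- homomorphically into the target; here the coefficients are the integers.
module IntegerRingSolver {c ℓ : Level} (R : CommutativeRing c ℓ) where
  open import Data.Maybe using (Maybe; just; nothing)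
  open import Relation.Nullary using (yes; no)
  open import Data.Integer.Base as ℤ using (ℤ; +_; -[1+_]; sign; ∣_∣; _◃_; _⊖_)
  import Data.Integer.Properties as ℤ
  import Data.Nat.Base as ℕ
  import Data.Nat.Properties as ℕ
  open import Data.Sign.Base as Sign using (Sign)
  open import Algebra.Solver.Ring.AlmostCommutativeRing
    using (_-Raw-AlmostCommutative⟶_; fromCommutativeRing)
  open CommutativeRing R hiding (zero)
  open import Algebra.Properties.Semiring.Mult.TCOptimised semiring
    using (×-homo-+; ×1-homo-*) renaming (_×_ to _×ₙ_)
  open import Algebra.Properties.Ring ring
    using (-0#≈0#; -‿involutive; -‿distribˡ-*; -‿distribʳ-*; -‿+-comm)

  ⟦_⟧ℕ : ℕ → Carrier
  ⟦ n ⟧ℕ = n ×ₙ 1#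

  ⟦_⟧ℤ : ℤ → Carrier
  ⟦ + n ⟧ℤ    = ⟦ n ⟧ℕ
  ⟦ -[1+ n ] ⟧ℤ = - ⟦ suc n ⟧ℕ

  ⊖-homo : ∀ m n → ⟦ m ⊖ n ⟧ℤ ≈ ⟦ m ⟧ℕ - ⟦ n ⟧ℕ
  ⊖-homo zero    zero    = sym (trans (+-identityˡ _) -0#≈0#)
  ⊖-homo zero    (suc n) = sym (+-identityˡ _)
  ⊖-homo (suc m) zero    = sym (trans (+-congˡ -0#≈0#) (+-identityʳ _))
  ⊖-homo (suc m) (suc n) = begin
    ⟦ suc m ⊖ suc n ⟧ℤ                   ≡⟨ ≡.cong ⟦_⟧ℤ (ℤ.[1+m]⊖[1+n]≡m⊖n m n) ⟩
    ⟦ m ⊖ n ⟧ℤ                           ≈⟨ ⊖-homo m n ⟩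
    ⟦ m ⟧ℕ - ⟦ n ⟧ℕ                      ≈⟨ cancel ⟦ m ⟧ℕ ⟦ n ⟧ℕ ⟩
    (1# + ⟦ m ⟧ℕ) - (1# + ⟦ n ⟧ℕ)        ≈⟨ +-cong (×-homo-+ 1# 1 m) (-‿cong (×-homo-+ 1# 1 n)) ⟨
    ⟦ suc m ⟧ℕ - ⟦ suc n ⟧ℕ              ∎
    where
    open import Relation.Binary.Reasoning.Setoid setoid
    cancel : ∀ x y → x - y ≈ (1# + x) - (1# + y)
    cancel x y = begin
      x - y                        ≈⟨ +-identityˡ _ ⟨
      0# + (x - y)                 ≈⟨ +-congʳ (-‿inverseʳ 1#) ⟨
      (1# - 1#) + (x - y)          ≈⟨ +-assoc 1# (- 1#) (x - y) ⟩
      1# + (- 1# + (x - y))        ≈⟨ +-congˡ (+-assoc (- 1#) x (- y)) ⟨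
      1# + ((- 1# + x) - y)        ≈⟨ +-congˡ (+-congʳ (+-comm (- 1#) x)) ⟩
      1# + ((x - 1#) - y)          ≈⟨ +-congˡ (+-assoc x (- 1#) (- y)) ⟩
      1# + (x + (- 1# - y))        ≈⟨ +-congˡ (+-congˡ (-‿+-comm 1# y)) ⟩
      1# + (x + - (1# + y))        ≈⟨ +-assoc 1# x _ ⟨
      (1# + x) - (1# + y)          ∎

  +-homo : ∀ i j → ⟦ i ℤ.+ j ⟧ℤ ≈ ⟦ i ⟧ℤ + ⟦ j ⟧ℤ
  +-homo -[1+ m ] -[1+ n ] =
    trans (-‿cong (trans (reflexive (≡.cong (λ k → ⟦ suc k ⟧ℕ) (≡.sym (ℕ.+-suc m n))))
                         (×-homo-+ 1# (suc m) (suc n))))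
          (sym (-‿+-comm _ _))
  +-homo -[1+ m ] (+ n)    = trans (⊖-homo n (suc m)) (+-comm _ _)
  +-homo (+ m)    -[1+ n ] = ⊖-homo m (suc n)
  +-homo (+ m)    (+ n)    = ×-homo-+ 1# m n

  signed : Sign → Carrier → Carrier
  signed Sign.+ x = x
  signed Sign.- x = - x

  signed-cong : ∀ s {x y} → x ≈ y → signed s x ≈ signed s y
  signed-cong Sign.+ x≈y = x≈y
  signed-cong Sign.- x≈y = -‿cong x≈y

  ◃-homo : ∀ s k → ⟦ s ◃ k ⟧ℤ ≈ signed s ⟦ k ⟧ℕ
  ◃-homo Sign.+ zero    = refl
  ◃-homo Sign.- zero    = sym -0#≈0#
  ◃-homo Sign.+ (suc k) = refl
  ◃-homo Sign.- (suc k) = refl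

  ⟦⟧ℤ-sign-abs : ∀ i → ⟦ i ⟧ℤ ≈ signed (sign i) ⟦ ∣ i ∣ ⟧ℕ
  ⟦⟧ℤ-sign-abs (+ n)    = refl
  ⟦⟧ℤ-sign-abs -[1+ n ] = refl

  signed-* : ∀ s t x y → signed (s Sign.* t) (x * y) ≈ signed s x * signed t y
  signed-* Sign.+ Sign.+ x y = refl
  signed-* Sign.+ Sign.- x y = -‿distribʳ-* x y
  signed-* Sign.- Sign.+ x y = -‿distribˡ-* x y
  signed-* Sign.- Sign.- x y =
    trans (sym (-‿involutive _)) (trans (-‿cong (-‿distribʳ-* x y)) (-‿distribˡ-* x (- y)))

  *-homo : ∀ i j → ⟦ i ℤ.* j ⟧ℤ ≈ ⟦ i ⟧ℤ * ⟦ j ⟧ℤ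
  *-homo i j =
    trans (◃-homo (sign i Sign.* sign j) (∣ i ∣ ℕ.* ∣ j ∣))
    (trans (signed-cong (sign i Sign.* sign j) (×1-homo-* ∣ i ∣ ∣ j ∣))
    (trans (signed-* (sign i) (sign j) _ _)
           (sym (*-cong (⟦⟧ℤ-sign-abs i) (⟦⟧ℤ-sign-abs j)))))

  neg-homo : ∀ i → ⟦ ℤ.- i ⟧ℤ ≈ - ⟦ i ⟧ℤ
  neg-homo -[1+ n ]  = sym (-‿involutive _)
  neg-homo (+ zero)  = sym -0#≈0#
  neg-homo (+ suc n) = refl

  ⟦⟧ℤ-homomorphism : ℤ.+-*-rawRing -Raw-AlmostCommutative⟶ fromCommutativeRing R
  ⟦⟧ℤ-homomorphism = record
    { ⟦_⟧    = ⟦_⟧ℤ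
    ; +-homo = +-homo
    ; *-homo = *-homo
    ; -‿homo = neg-homo
    ; 0-homo = refl
    ; 1-homo = refl
    }

  ⟦⟧ℤ-equal? : ∀ i j → Maybe (⟦ i ⟧ℤ ≈ ⟦ j ⟧ℤ)
  ⟦⟧ℤ-equal? i j with i ℤ.≟ j
  ... | yes ≡.refl = just refl
  ... | no _       = nothing

  open import Algebra.Solver.Ring ℤ.+-*-rawRing (fromCommutativeRing R)
    ⟦⟧ℤ-homomorphism ⟦⟧ℤ-equal? public

module ContinuedFractionVectors {c ℓ : Level} (R : CommutativeRing c ℓ) where
  open CommutativeRing R hiding (zero)
  open CF R
  open IntegerRingSolver R using (solve; _:=_; _:+_; _:-_; _:*_; :-_; con)
  open import Data.Integer.Base using (+_)
  open import Relation.Binary.Reasoning.Setoid setoid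

  -- Equality of formal fractions is not transitive over rings with zero
  -- divisors, so vectors are compared componentwise, up to explicit scalars.
  infix 4 _≋_ _∝_
  infixr 7 _⋆_

  _≋_ : Frac → Frac → Set ℓ
  (u₁ , u₂) ≋ (v₁ , v₂) = (u₁ ≈ v₁) × (u₂ ≈ v₂)

  ≋-refl : ∀ {u} → u ≋ u
  ≋-refl = refl , refl

  ≋-sym : ∀ {u v} → u ≋ v → v ≋ u
  ≋-sym (p₁ , p₂) = sym p₁ , sym p₂

  ≋-trans : ∀ {u v w} → u ≋ v → v ≋ w → u ≋ w
  ≋-trans (p₁ , p₂) (q₁ , q₂) = trans p₁ q₁ , trans p₂ q₂

  ≋-reflexive : ∀ {u v} → u ≡ v → u ≋ v
  ≋-reflexive ≡.refl = ≋-refl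

  _⋆_ : Carrier → Frac → Frac
  s ⋆ (u , v) = (s * u , s * v)

  ⋆-cong : ∀ s {u v} → u ≋ v → s ⋆ u ≋ s ⋆ v
  ⋆-cong s (p₁ , p₂) = *-congˡ p₁ , *-congˡ p₂

  _∝_ : Frac → Frac → Set (c Level.⊔ ℓ)
  u ∝ v = Σ Carrier λ s → u ≋ s ⋆ v

  ≋⇒∝ : ∀ {u v} → u ≋ v → u ∝ v
  ≋⇒∝ u≋v = 1# , ≋-trans u≋v (sym (*-identityˡ _) , sym (*-identityˡ _))

  ∝-trans : ∀ {u v w} → u ∝ v → v ∝ w → u ∝ w
  ∝-trans (s , (p₁ , p₂)) (t , (q₁ , q₂)) =
    s * t , ( trans p₁ (trans (*-congˡ q₁) (sym (*-assoc s t _)))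
            , trans p₂ (trans (*-congˡ q₂) (sym (*-assoc s t _))) )

  ∝-respʳ-≋ : ∀ {u v w} → u ∝ v → v ≋ w → u ∝ w
  ∝-respʳ-≋ u∝v v≋w = ∝-trans u∝v (≋⇒∝ v≋w)

  ∝-respˡ-≋ : ∀ {u v w} → u ≋ v → v ∝ w → u ∝ w
  ∝-respˡ-≋ u≋v v∝w = ∝-trans (≋⇒∝ u≋v) v∝w

  e₁ : Frac
  e₁ = (1# , 0#)

  push : Carrier → Frac → Frac
  push y (u , v) = (y * u + v , u)

  push-cong : ∀ y {u v} → u ≋ v → push y u ≋ push y v
  push-cong y (p₁ , p₂) = +-cong (*-congˡ p₁) p₂ , p₁

  evalCF : List Carrier → Frac → Frac
  evalCF bs w = foldr push w bs

  cf≋push-evalCF : ∀ b bs → cf b bs ≋ push b (evalCF bs e₁)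
  cf≋push-evalCF b [] = sym (trans (+-identityʳ _) (*-identityʳ b)) , refl
  cf≋push-evalCF b (b′ ∷ bs) with cf≋push-evalCF b′ bs
  ... | (p₁ , p₂) = +-cong (*-congˡ (1*-≈ p₁)) (1*-≈ (1*-≈ p₂)) , 1*-≈ (1*-≈ p₁)
    where
    1*-≈ : ∀ {x y} → x ≈ y → 1# * x ≈ y
    1*-≈ x≈y = trans (*-identityˡ _) x≈y

  record Mat : Set c where
    constructor mat
    field α β γ δ : Carrier
  open Mat

  act : Mat → Frac → Frac
  act (mat A B C D) (u , v) = (A * u + B * v , C * u + D * v)

  det : Mat → Carrier
  det (mat A B C D) = A * D - B * C

  -- M · [[y , 1] , [1 , 0]], the matrix of push y
  _◂_ : Mat → Carrier → Mat
  mat A B C D ◂ y = mat (A * y + B) A (C * y + D) C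

  -- P · adj M · P with P = [[0 , 1] , [1 , 0]]: an anti-automorphism sending
  -- the matrix of push y to minus the matrix of push (- y)
  mirror : Mat → Mat
  mirror (mat A B C D) = mat A (- C) (- B) D

  act-◂ : ∀ M y w → act (M ◂ y) w ≋ act M (push y w)
  act-◂ (mat A B C D) y (u , v) = row A B , row C D
    where
    row : ∀ A B → (A * y + B) * u + A * v ≈ A * (y * u + v) + B * u
    row A B = solve 5 (λ A B y u v → (A :* y :+ B) :* u :+ A :* v := A :* (y :* u :+ v) :+ B :* u)
                refl A B y u v

  det-◂ : ∀ M y → det (M ◂ y) ≈ - det M
  det-◂ (mat A B C D) y =
    solve 5 (λ A B C D y → (A :* y :+ B) :* C :- A :* (C :* y :+ D) := :- (A :* D :- B :* C))
      refl A B C D y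

  push-neg-act-mirror : ∀ M y s w →
    push (- y) (s ⋆ act (mirror M) w) ≋ (- s) ⋆ act (mirror (M ◂ y)) w
  push-neg-act-mirror (mat A B C D) y s (u , v) =
    solve 8 (λ A B C D y s u v →
        (:- y) :* (s :* (A :* u :+ (:- C) :* v)) :+ s :* ((:- B) :* u :+ D :* v)
      := (:- s) :* ((A :* y :+ B) :* u :+ (:- (C :* y :+ D)) :* v))
      refl A B C D y s u v ,
    solve 5 (λ A C s u v → s :* (A :* u :+ (:- C) :* v) := (:- s) :* ((:- A) :* u :+ C :* v))
      refl A C s u v

  -- If r represents R, then offset⁻ M r represents α/R - γ and offset⁺ M r
  -- represents α/R + β.
  offset⁻ offset⁺ : Mat → Frac → Frac
  offset⁻ M (r₁ , r₂) = (α M * r₂ - γ M * r₁ , r₁)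
  offset⁺ M (r₁ , r₂) = (α M * r₂ + β M * r₁ , r₁)

  infix 6 _÷[_⊕_]
  _÷[_⊕_] : Carrier → Carrier → Frac → Frac
  d ÷[ t ⊕ e ] = emb d /F (emb t +F e)

  ÷-unfold : ∀ d t u v → d ÷[ t ⊕ (u , v) ] ≋ (d * v , t * v + u)
  ÷-unfold d t u v = *-congˡ (*-identityˡ v) , trans (*-identityˡ _) (+-congˡ (*-identityˡ u))

  ÷-cong : ∀ {d d′ t t′ e e′} → d ≈ d′ → t ≈ t′ → e ≋ e′ → d ÷[ t ⊕ e ] ≋ d′ ÷[ t′ ⊕ e′ ]
  ÷-cong d≈d′ t≈t′ (p₁ , p₂) =
    *-cong d≈d′ (*-congˡ p₂) , *-congˡ (+-cong (*-cong t≈t′ p₂) (*-congˡ p₁))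

  ÷-⋆ : ∀ d t s e → d ÷[ t ⊕ s ⋆ e ] ≋ s ⋆ (d ÷[ t ⊕ e ])
  ÷-⋆ d t s (u , v) =
    ≋-trans (÷-unfold d t (s * u) (s * v))
      (≋-trans (solve 5 (λ d t s u v → d :* (s :* v) := s :* (d :* v)) refl d t s u v
               , solve 5 (λ d t s u v → t :* (s :* v) :+ s :* u := s :* (t :* v :+ u)) refl d t s u v)
        (≋-sym (⋆-cong s (÷-unfold d t u v))))

  ÷-resp-∝ : ∀ d t {u v} → u ∝ v → d ÷[ t ⊕ u ] ∝ d ÷[ t ⊕ v ]
  ÷-resp-∝ d t {v = v} (s , u≋s⋆v) = s , ≋-trans (÷-cong refl refl u≋s⋆v) (÷-⋆ d t s v)

  offset⁻-act-push : ∀ M x r → offset⁻ M (act M (push x r)) ≋ det M ÷[ x * α M ⊕ offset⁺ M r ]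
  offset⁻-act-push (mat A B C D) x (r₁ , r₂) =
    ≋-trans
      ( solve 7 (λ A B C D x r₁ r₂ →
            A :* (C :* (x :* r₁ :+ r₂) :+ D :* r₁) :- C :* (A :* (x :* r₁ :+ r₂) :+ B :* r₁)
          := (A :* D :- B :* C) :* r₁)
          refl A B C D x r₁ r₂
      , solve 5 (λ A B x r₁ r₂ →
            A :* (x :* r₁ :+ r₂) :+ B :* r₁ := x :* A :* r₁ :+ (A :* r₂ :+ B :* r₁))
          refl A B x r₁ r₂ )
      (≋-sym (÷-unfold _ _ _ _))

  offset⁺-act-mirror-push : ∀ M x r →
    offset⁺ M (act (mirror M) (push x r)) ≋ det M ÷[ x * α M ⊕ offset⁻ M r ]
  offset⁺-act-mirror-push (mat A B C D) x (r₁ , r₂) =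
    ≋-trans
      ( solve 7 (λ A B C D x r₁ r₂ →
            A :* ((:- B) :* (x :* r₁ :+ r₂) :+ D :* r₁) :+ B :* (A :* (x :* r₁ :+ r₂) :+ (:- C) :* r₁)
          := (A :* D :- B :* C) :* r₁)
          refl A B C D x r₁ r₂
      , solve 5 (λ A C x r₁ r₂ →
            A :* (x :* r₁ :+ r₂) :+ (:- C) :* r₁ := x :* A :* r₁ :+ (A :* r₂ :- C :* r₁))
          refl A C x r₁ r₂ )
      (≋-sym (÷-unfold _ _ _ _))

  offset⁻-act-e₁ : ∀ M → offset⁻ M (act M e₁) ≋ α M ⋆ (0# , 1#)
  offset⁻-act-e₁ (mat A B C D) =
    solve 4 (λ A B C D →
        A :* (C :* con (+ 1) :+ D :* con (+ 0)) :- C :* (A :* con (+ 1) :+ B :* con (+ 0))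
      := A :* con (+ 0))
      refl A B C D ,
    solve 2 (λ A B → A :* con (+ 1) :+ B :* con (+ 0) := A :* con (+ 1)) refl A B

  offset⁺-act-mirror-e₁ : ∀ M → offset⁺ M (act (mirror M) e₁) ≋ α M ⋆ (0# , 1#)
  offset⁺-act-mirror-e₁ (mat A B C D) =
    solve 4 (λ A B C D →
        A :* ((:- B) :* con (+ 1) :+ D :* con (+ 0)) :+ B :* (A :* con (+ 1) :+ (:- C) :* con (+ 0))
      := A :* con (+ 0))
      refl A B C D ,
    solve 2 (λ A C → A :* con (+ 1) :+ (:- C) :* con (+ 0) := A :* con (+ 1)) refl A C

  offset⁺-⋆ : ∀ M s r → offset⁺ M (s ⋆ r) ≋ s ⋆ offset⁺ M r
  offset⁺-⋆ (mat A B C D) s (r₁ , r₂) =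
    solve 5 (λ A B s r₁ r₂ → A :* (s :* r₂) :+ B :* (s :* r₁) := s :* (A :* r₂ :+ B :* r₁))
      refl A B s r₁ r₂ ,
    refl

  ≋-≈F-trans : ∀ {u v w} → u ≋ v → v ≈F w → u ≈F w
  ≋-≈F-trans (p₁ , p₂) v≈w = trans (*-congʳ p₁) (trans v≈w (*-congˡ (sym p₂)))

  -- If r represents R then push a₀ r is a₀ + 1/R, while offset⁻ M r is α/R - γ;
  -- with p = a₀α + γ and q = α this says a₀ + 1/R = p/q + (α/R - γ)/q.
  push-≈F : ∀ a₀ p q M r s t → p ≈ a₀ * α M + γ M → q ≈ α M → offset⁻ M r ≋ s ⋆ t →
            push a₀ r ≈F (p , q) +F ((1# , q) *F t)
  push-≈F a₀ p q (mat A B C D) (r₁ , r₂) s (t₁ , t₂) p≈ q≈ (h₁ , r₁≈) = sym (begin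
    (p * (q * t₂) + q * (1# * t₁)) * r₁
      ≈⟨ *-cong (+-cong (*-cong p≈ (*-congʳ q≈)) (*-congʳ q≈)) r₁≈ ⟩
    ((a₀ * A + C) * (A * t₂) + A * (1# * t₁)) * (s * t₂)
      ≈⟨ solve 6 (λ a₀ A C s t₁ t₂ →
             ((a₀ :* A :+ C) :* (A :* t₂) :+ A :* (con (+ 1) :* t₁)) :* (s :* t₂)
           := A :* t₂ :* (a₀ :* A :* (s :* t₂) :+ (C :* (s :* t₂) :+ s :* t₁)))
           refl a₀ A C s t₁ t₂ ⟩
    A * t₂ * (a₀ * A * (s * t₂) + (C * (s * t₂) + s * t₁))
      ≈⟨ *-congˡ (+-cong (*-congˡ r₁≈) (+-cong (*-congˡ r₁≈) h₁)) ⟨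
    A * t₂ * (a₀ * A * r₁ + (C * r₁ + (A * r₂ - C * r₁)))
      ≈⟨ solve 6 (λ a₀ A C r₁ r₂ t₂ →
             A :* t₂ :* (a₀ :* A :* r₁ :+ (C :* r₁ :+ (A :* r₂ :- C :* r₁)))
           := (a₀ :* r₁ :+ r₂) :* (A :* (A :* t₂)))
           refl a₀ A C r₁ r₂ t₂ ⟩
    (a₀ * r₁ + r₂) * (A * (A * t₂))
      ≈⟨ *-congˡ (*-cong q≈ (*-congʳ q≈)) ⟨
    (a₀ * r₁ + r₂) * (q * (q * t₂)) ∎)

  wordMat : ℕ → (ℕ → Carrier) → Mat
  wordMat zero    a = mat 1# 0# 0# 1#
  wordMat (suc n) a = wordMat n a ◂ a (suc n)

  evalCF-W : ∀ n a w → evalCF (W n a) w ≋ act (wordMat n a) w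
  evalCF-W zero a (u , v) =
    solve 2 (λ u v → u := con (+ 1) :* u :+ con (+ 0) :* v) refl u v ,
    solve 2 (λ u v → v := con (+ 0) :* u :+ con (+ 1) :* v) refl u v
  evalCF-W (suc n) a w =
    ≋-trans (≋-reflexive (foldr-++ push w (range1 n a) (a (suc n) ∷ [])))
      (≋-trans (evalCF-W n a (push (a (suc n)) w)) (≋-sym (act-◂ (wordMat n a) (a (suc n)) w)))

  Wbar-suc : ∀ n a → Wbar (suc n) a ≡ - a (suc n) ∷ Wbar n a
  Wbar-suc n a = ≡.cong (map (-_)) (reverse-++ (range1 n a) (a (suc n) ∷ []))

  evalCF-Wbar : ∀ n a w → evalCF (Wbar n a) w ≋ sgn n ⋆ act (mirror (wordMat n a)) w
  evalCF-Wbar zero a (u , v) =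
    solve 2 (λ u v → u := con (+ 1) :* (con (+ 1) :* u :+ (:- con (+ 0)) :* v)) refl u v ,
    solve 2 (λ u v → v := con (+ 1) :* ((:- con (+ 0)) :* u :+ con (+ 1) :* v)) refl u v
  evalCF-Wbar (suc n) a w rewrite Wbar-suc n a =
    ≋-trans (push-cong (- a (suc n)) (evalCF-Wbar n a w))
      (push-neg-act-mirror (wordMat n a) (a (suc n)) (sgn n) w)

  det-wordMat : ∀ n a → det (wordMat n a) ≈ sgn n
  det-wordMat zero    a = solve 0 (con (+ 1) :* con (+ 1) :- con (+ 0) :* con (+ 0) := con (+ 1)) refl
  det-wordMat (suc n) a = trans (det-◂ (wordMat n a) (a (suc n))) (-‿cong (det-wordMat n a))

  -- pₙ / qₙ = [a₀ , W]
  conv≋push-wordMat : ∀ a j → conv a j ≋ push (a 0) (α (wordMat j a) , γ (wordMat j a))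
  conv≋push-wordMat a zero = sym (trans (+-identityʳ _) (*-identityʳ (a 0))) , refl
  conv≋push-wordMat a (suc zero) =
    solve 2 (λ a₀ a₁ → a₀ :* a₁ :+ con (+ 1)
                      := a₀ :* (con (+ 1) :* a₁ :+ con (+ 0)) :+ (con (+ 0) :* a₁ :+ con (+ 1)))
      refl (a 0) (a 1) ,
    solve 1 (λ a₁ → a₁ := con (+ 1) :* a₁ :+ con (+ 0)) refl (a 1)
  conv≋push-wordMat a (suc (suc j))
    with conv≋push-wordMat a (suc j) | conv≋push-wordMat a j
  ... | (p₁ , q₁) | (p₀ , q₀) =
    trans (+-cong (*-congˡ p₁) p₀)
      (solve 6 (λ a₀ y A′ C′ A C → y :* (a₀ :* A′ :+ C′) :+ (a₀ :* A :+ C)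
                                := a₀ :* (A′ :* y :+ A) :+ (C′ :* y :+ C))
         refl (a 0) y (α M) (γ M) (α (wordMat j a)) (γ (wordMat j a))) ,
    trans (+-cong (*-congˡ q₁) q₀) (+-congʳ (*-comm y (α M)))
    where
    y : Carrier
    y = a (suc (suc j))
    M : Mat
    M = wordMat (suc j) a

  module Blocks (n : ℕ) (a : ℕ → Carrier) where
    M : Mat
    M = wordMat n a

    ε q : Carrier
    ε = sgn n
    q = qconv a n

    blockAct : Bool → Frac → Frac
    blockAct true  w = act M w
    blockAct false w = ε ⋆ act (mirror M) w

    offset : Bool → Frac → Frac
    offset true  = offset⁻ M
    offset false = offset⁺ M

    offset-cong : ∀ b {u v} → u ≋ v → offset b u ≋ offset b v
    offset-cong true  (p₁ , p₂) = +-cong (*-congˡ p₂) (-‿cong (*-congˡ p₁)) , p₁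
    offset-cong false (p₁ , p₂) = +-cong (*-congˡ p₂) (*-congˡ p₁) , p₁

    evalCF-block : ∀ i w → evalCF (block n a i) w ≋ blockAct (odd i) w
    evalCF-block i w with odd i
    ... | true  = evalCF-W n a w
    ... | false = evalCF-Wbar n a w

    ÷-det-α : ∀ x e → det M ÷[ x * α M ⊕ e ] ≋ ε ÷[ x * q ⊕ e ]
    ÷-det-α x e = ÷-cong (det-wordMat n a) (*-congˡ (sym (conv≋push-wordMat a n .proj₂))) ≋-refl

    offset-blockAct-push : ∀ b x r → offset b (blockAct b (push x r)) ∝ ε ÷[ x * q ⊕ offset (not b) r ]
    offset-blockAct-push true x r = ≋⇒∝ (≋-trans (offset⁻-act-push M x r) (÷-det-α x _))
    offset-blockAct-push false x r =
      ε , ≋-trans (offset⁺-⋆ M ε _)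
            (⋆-cong ε (≋-trans (offset⁺-act-mirror-push M x r) (÷-det-α x _)))

    offset-blockAct-e₁ : ∀ b → offset b (blockAct b e₁) ∝ (0# , 1#)
    offset-blockAct-e₁ true  = α M , offset⁻-act-e₁ M
    offset-blockAct-e₁ false =
      ∝-trans (ε , ≋-trans (offset⁺-⋆ M ε _) (⋆-cong ε (offset⁺-act-mirror-e₁ M))) (α M , ≋-refl)

    module Tails (x : ℕ → Carrier) where
      offset-block-cons : ∀ i bs →
        offset (odd i) (evalCF (block n a i ++ x i ∷ bs) e₁)
          ∝ ε ÷[ x i * q ⊕ offset (odd (suc i)) (evalCF bs e₁) ]
      offset-block-cons i bs =
        ∝-respˡ-≋
          (offset-cong (odd i)
            (≋-trans (≋-reflexive (foldr-++ push e₁ (block n a i) (x i ∷ bs)))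
                     (evalCF-block i (push (x i) (evalCF bs e₁)))))
          (offset-blockAct-push (odd i) (x i) (evalCF bs e₁))

      offset-block : ∀ i → offset (odd i) (evalCF (block n a i) e₁) ∝ (0# , 1#)
      offset-block i =
        ∝-respˡ-≋ (offset-cong (odd i) (evalCF-block i e₁)) (offset-blockAct-e₁ (odd i))

      ÷-zero : ∀ i → ε ÷[ x i * q ⊕ (0# , 1#) ] ≋ T n a x i 0
      ÷-zero i = ≋-trans (÷-unfold ε (x i * q) 0# 1#)
                   (refl , trans (+-identityʳ _) (trans (*-identityʳ _) (sym (*-identityˡ _))))

      offset-words : ∀ m i → offset (odd i) (evalCF (words n a x i (suc m)) e₁) ∝ T n a x i m
      offset-words zero i =
        ∝-respʳ-≋
          (∝-trans (offset-block-cons i (block n a (suc i)))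
                   (÷-resp-∝ ε (x i * q) (offset-block (suc i))))
          (÷-zero i)
      offset-words (suc m) i =
        ∝-trans (offset-block-cons i (words n a x (suc i) (suc m)))
                (÷-resp-∝ ε (x i * q) (offset-words m (suc i)))

      S≈F-RHS : ∀ m → S n a x (suc (suc m)) ≈F RHS n a x m
      S≈F-RHS m with offset-words m 1
      ... | s , offset≋ =
        ≋-≈F-trans (cf≋push-evalCF (a 0) (words n a x 1 (suc m)))
          (push-≈F (a 0) _ _ M _ s _ (conv≋push-wordMat a n .proj₁)
                                     (conv≋push-wordMat a n .proj₂) offset≋)

corollary4p2 : {c ℓ : Level} (R : CommutativeRing c ℓ) →
    let open CF R in
    (n : ℕ) → 1 ≤ n → (a x : ℕ → CommutativeRing.Carrier R) → (k : ℕ) → 2 ≤ k →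
    S n a x k ≈F RHS n a x (k ∸ 2)
corollary4p2 R n _ a x zero          ()
corollary4p2 R n _ a x (suc zero)    (s≤s ())
corollary4p2 R n _ a x (suc (suc m)) _ = S≈F-RHS m
  where open ContinuedFractionVectors.Blocks.Tails R n a x
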